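{- Every locatable digraph $D$ of order $n$ has at most $n-1$ location-forced vertices.
   Context: Digraphs are finite and may contain loops; for each ordered pair $(x,y)$ there is at most one arc $xy$. $N^-(v)$ is the set of vertices $u$ such that $uv$ is an arc (including $v$ if $v$ has a loop). $D$ is locatable if no vertex has empty in-neighbourhood and no two distinct vertices have equal in-neighbourhoods (equivalently, it admits an open neighbourhood locating-dominating set). A vertex $v$ is location-forced if there are two distinct vertices $x,y$ with $N^-(x)\ominus N^-(y)=\{v\}$ ($\ominus$ = symmetric difference). -}

module Defs where

open import Data.Nat using (ℕ)
open import Data.Bool using (Bool; true; false; _xor_)
open import Data.Fin using (Fin)
open import Data.Fin.Subset using (Subset; ⁅_⁆; Empty)
open import Data.Vec using (tabulate; zipWith)
open import Data.Product using (∃₂; _×_)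
open import Relation.Binary.PropositionalEquality using (_≡_)
open import Relation.Nullary using (¬_)

-- A digraph of order n: vertex set Fin n, arc relation given by a Boolean
-- adjacency function (arc x → y present iff A x y ≡ true). Loops allowed,
-- at most one arc per ordered pair.
Digraph : ℕ → Set
Digraph n = Fin n → Fin n → Bool

N⁻ : ∀ {n} → Digraph n → Fin n → Subset n
N⁻ D v = tabulate (λ u → D u v)

_⊖_ : ∀ {n} → Subset n → Subset n → Subset n
p ⊖ q = zipWith _xor_ p q

Locatable : ∀ {n} → Digraph n → Set
Locatable {n} D =
  ((v : Fin n) → ¬ Empty (N⁻ D v)) ×
  ((x y : Fin n) → N⁻ D x ≡ N⁻ D y → x ≡ y)

LocationForced : ∀ {n} → Digraph n → Fin n → Set
LocationForced D v =
  ∃₂ λ x y → ¬ (x ≡ y) × (N⁻ D x ⊖ N⁻ D y ≡ ⁅ v ⁆)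

{-# OPTIONS --safe #-}
module Submission where

open import Defs
open import Data.Nat using (ℕ; zero; suc; _+_; _≤_; _∸_; z≤n; s≤s)
open import Data.Nat.Properties using (≤-refl; ≤-trans; ≤-reflexive; +-mono-≤; +-suc; +-monoʳ-≤; n≤1+n)
open import Data.Fin using (Fin; zero; suc)
open import Data.Fin.Subset using (Subset; _∈_; ∣_∣; _∪_; ⊥; ⁅_⁆)
open import Data.Fin.Subset.Properties using (p⊆q⇒∣p∣≤∣q∣; p⊆p∪q; q⊆p∪q; ∣p∣≤∣x∷p∣)
open import Data.Bool using (Bool; true; false)
open import Data.Bool.Properties using () renaming (_≟_ to _≟ᵇ_)
open import Data.Vec using ([]; _∷_; here; there)
open import Data.Vec.Properties using (≡-dec; ∷-injective)
open import Data.List using (List; length; tabulate) renaming ([] to []ₗ; _∷_ to _∷ₗ_)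
open import Data.List.Properties using (length-tabulate)
open import Data.List.Relation.Unary.Any using (Any; any?; satisfied) renaming (here to hereₗ; there to thereₗ)
open import Data.List.Membership.Propositional using (lose) renaming (_∈_ to _∈ₗ_)
open import Data.List.Membership.Propositional.Properties using (∈-tabulate⁺)
open import Data.Product using (_,_; proj₂)
open import Relation.Nullary using (Dec; yes; no; does; contradiction)
open import Relation.Binary.PropositionalEquality using (_≡_; refl; sym; cong; subst)

-- Let M be a family of m subsets of {0, …, k}. Split M by whether
-- a member contains 0. Two members whose symmetric difference is {0} lie in
-- different halves and have the same remaining part, so the two halves,
-- restricted to {1, …, k}, meet; two members whose symmetric difference is
-- {v} with v ≠ 0 lie in the same half. By induction each half of size mᵢ has
-- at most mᵢ - 1 singleton differences, and 0 contributes only when both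
-- halves are nonempty, giving at most m - 1 in total. Applied to the family
-- of in-neighbourhoods this bounds the location-forced vertices by n - 1.

private
  variable
    k : ℕ

tailsWithHead : Bool → List (Subset (suc k)) → List (Subset k)
tailsWithHead _ []ₗ = []ₗ
tailsWithHead false ((false ∷ p) ∷ₗ M) = p ∷ₗ tailsWithHead false M
tailsWithHead false ((true ∷ p) ∷ₗ M) = tailsWithHead false M
tailsWithHead true ((false ∷ p) ∷ₗ M) = tailsWithHead true M
tailsWithHead true ((true ∷ p) ∷ₗ M) = p ∷ₗ tailsWithHead true M

∈-tailsWithHead : ∀ {b} {p : Subset k} {M} → (b ∷ p) ∈ₗ M → p ∈ₗ tailsWithHead b M
∈-tailsWithHead {b = false} {M = (false ∷ _) ∷ₗ _} (hereₗ refl) = hereₗ refl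
∈-tailsWithHead {b = true} {M = (true ∷ _) ∷ₗ _} (hereₗ refl) = hereₗ refl
∈-tailsWithHead {b = false} {M = (false ∷ _) ∷ₗ _} (thereₗ p∈M) = thereₗ (∈-tailsWithHead p∈M)
∈-tailsWithHead {b = false} {M = (true ∷ _) ∷ₗ _} (thereₗ p∈M) = ∈-tailsWithHead p∈M
∈-tailsWithHead {b = true} {M = (false ∷ _) ∷ₗ _} (thereₗ p∈M) = ∈-tailsWithHead p∈M
∈-tailsWithHead {b = true} {M = (true ∷ _) ∷ₗ _} (thereₗ p∈M) = thereₗ (∈-tailsWithHead p∈M)

length-tailsWithHead : (M : List (Subset (suc k))) →
  length (tailsWithHead false M) + length (tailsWithHead true M) ≡ length M
length-tailsWithHead []ₗ = refl
length-tailsWithHead ((false ∷ _) ∷ₗ M) = cong suc (length-tailsWithHead M)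
length-tailsWithHead ((true ∷ _) ∷ₗ M)
  rewrite +-suc (length (tailsWithHead false M)) (length (tailsWithHead true M)) =
    cong suc (length-tailsWithHead M)

Meet : List (Subset k) → List (Subset k) → Set
Meet A B = Any (_∈ₗ B) A

meet? : (A B : List (Subset k)) → Dec (Meet A B)
meet? A B = any? (λ p → any? (p ≟_) B) A
  where _≟_ = ≡-dec _≟ᵇ_

singletonDifferences : List (Subset k) → Subset k
singletonDifferences {zero} M = []
singletonDifferences {suc k} M =
  does (meet? (tailsWithHead false M) (tailsWithHead true M)) ∷
    (singletonDifferences (tailsWithHead false M) ∪ singletonDifferences (tailsWithHead true M))

⊖≡⊥⇒≡ : (p q : Subset k) → p ⊖ q ≡ ⊥ → p ≡ q
⊖≡⊥⇒≡ [] [] _ = refl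
⊖≡⊥⇒≡ (a ∷ p) (b ∷ q) p⊖q≡⊥ with ∷-injective p⊖q≡⊥
⊖≡⊥⇒≡ (false ∷ p) (false ∷ q) _ | _ , eq = cong (false ∷_) (⊖≡⊥⇒≡ p q eq)
⊖≡⊥⇒≡ (true ∷ p) (true ∷ q) _ | _ , eq = cong (true ∷_) (⊖≡⊥⇒≡ p q eq)

meet⇒zero∈singletonDifferences : (M : List (Subset (suc k))) →
  Meet (tailsWithHead false M) (tailsWithHead true M) → zero ∈ singletonDifferences M
meet⇒zero∈singletonDifferences M meet with meet? (tailsWithHead false M) (tailsWithHead true M)
... | yes _ = here
... | no ¬meet = contradiction meet ¬meet

⊖≡⁅⁆⇒∈singletonDifferences : ∀ (M : List (Subset k)) {p q} v → p ∈ₗ M → q ∈ₗ M →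
  p ⊖ q ≡ ⁅ v ⁆ → v ∈ singletonDifferences M
⊖≡⁅⁆⇒∈singletonDifferences M {false ∷ p} {false ∷ q} zero _ _ ()
⊖≡⁅⁆⇒∈singletonDifferences M {true ∷ p} {true ∷ q} zero _ _ ()
⊖≡⁅⁆⇒∈singletonDifferences M {false ∷ p} {true ∷ q} zero p∈M q∈M eq =
  meet⇒zero∈singletonDifferences M (lose (∈-tailsWithHead p∈M) p∈M₁)
  where
  p∈M₁ : p ∈ₗ tailsWithHead true M
  p∈M₁ = subst (_∈ₗ _) (sym (⊖≡⊥⇒≡ p q (proj₂ (∷-injective eq)))) (∈-tailsWithHead q∈M)
⊖≡⁅⁆⇒∈singletonDifferences M {true ∷ p} {false ∷ q} zero p∈M q∈M eq =
  meet⇒zero∈singletonDifferences M (lose (∈-tailsWithHead q∈M) q∈M₁)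
  where
  q∈M₁ : q ∈ₗ tailsWithHead true M
  q∈M₁ = subst (_∈ₗ _) (⊖≡⊥⇒≡ p q (proj₂ (∷-injective eq))) (∈-tailsWithHead p∈M)
⊖≡⁅⁆⇒∈singletonDifferences M {false ∷ p} {true ∷ q} (suc v) _ _ ()
⊖≡⁅⁆⇒∈singletonDifferences M {true ∷ p} {false ∷ q} (suc v) _ _ ()
⊖≡⁅⁆⇒∈singletonDifferences M {false ∷ p} {false ∷ q} (suc v) p∈M q∈M eq =
  there (p⊆p∪q _ (⊖≡⁅⁆⇒∈singletonDifferences (tailsWithHead false M) v
    (∈-tailsWithHead p∈M) (∈-tailsWithHead q∈M) (proj₂ (∷-injective eq))))
⊖≡⁅⁆⇒∈singletonDifferences M {true ∷ p} {true ∷ q} (suc v) p∈M q∈M eq =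
  there (q⊆p∪q _ _ (⊖≡⁅⁆⇒∈singletonDifferences (tailsWithHead true M) v
    (∈-tailsWithHead p∈M) (∈-tailsWithHead q∈M) (proj₂ (∷-injective eq))))

∣p∪q∣≤∣p∣+∣q∣ : (p q : Subset k) → ∣ p ∪ q ∣ ≤ ∣ p ∣ + ∣ q ∣
∣p∪q∣≤∣p∣+∣q∣ [] [] = z≤n
∣p∪q∣≤∣p∣+∣q∣ (true ∷ p) (b ∷ q) =
  s≤s (≤-trans (∣p∪q∣≤∣p∣+∣q∣ p q) (+-monoʳ-≤ ∣ p ∣ (∣p∣≤∣x∷p∣ b q)))
∣p∪q∣≤∣p∣+∣q∣ (false ∷ p) (true ∷ q) =
  ≤-trans (s≤s (∣p∪q∣≤∣p∣+∣q∣ p q)) (≤-reflexive (sym (+-suc ∣ p ∣ ∣ q ∣)))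
∣p∪q∣≤∣p∣+∣q∣ (false ∷ p) (false ∷ q) = ∣p∪q∣≤∣p∣+∣q∣ p q

m∸1+n∸1≤m+n∸1 : (m n : ℕ) → (m ∸ 1) + (n ∸ 1) ≤ (m + n) ∸ 1
m∸1+n∸1≤m+n∸1 zero n = ≤-refl
m∸1+n∸1≤m+n∸1 (suc m) zero = ≤-refl
m∸1+n∸1≤m+n∸1 (suc m) (suc n) = ≤-trans (n≤1+n (m + n)) (≤-reflexive (sym (+-suc m n)))

-- The first coordinate costs one more only when both halves are nonempty.
∣does∷∣≤length+length∸1 : (A B : List (Subset k)) (meet : Dec (Meet A B)) (U : Subset k) →
  ∣ U ∣ ≤ (length A ∸ 1) + (length B ∸ 1) → ∣ does meet ∷ U ∣ ≤ (length A + length B) ∸ 1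
∣does∷∣≤length+length∸1 A B (no _) U ∣U∣≤ = ≤-trans ∣U∣≤ (m∸1+n∸1≤m+n∸1 (length A) (length B))
∣does∷∣≤length+length∸1 (_ ∷ₗ A) (_ ∷ₗ B) (yes _) U ∣U∣≤ =
  ≤-trans (s≤s ∣U∣≤) (≤-reflexive (sym (+-suc (length A) (length B))))
∣does∷∣≤length+length∸1 []ₗ B (yes ()) U
∣does∷∣≤length+length∸1 (_ ∷ₗ A) []ₗ (yes meet) U _ with proj₂ (satisfied meet)
... | ()

∣singletonDifferences∣≤length∸1 : (M : List (Subset k)) → ∣ singletonDifferences M ∣ ≤ length M ∸ 1
∣singletonDifferences∣≤length∸1 {zero} M = z≤n
∣singletonDifferences∣≤length∸1 {suc k} M =
  ≤-trans (∣does∷∣≤length+length∸1 M₀ M₁ (meet? M₀ M₁)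
            (singletonDifferences M₀ ∪ singletonDifferences M₁) ∣U₀∪U₁∣≤)
          (≤-reflexive (cong (_∸ 1) (length-tailsWithHead M)))
  where
  M₀ M₁ : List (Subset k)
  M₀ = tailsWithHead false M
  M₁ = tailsWithHead true M
  ∣U₀∪U₁∣≤ : ∣ singletonDifferences M₀ ∪ singletonDifferences M₁ ∣ ≤ (length M₀ ∸ 1) + (length M₁ ∸ 1)
  ∣U₀∪U₁∣≤ = ≤-trans (∣p∪q∣≤∣p∣+∣q∣ (singletonDifferences M₀) (singletonDifferences M₁))
    (+-mono-≤ (∣singletonDifferences∣≤length∸1 M₀) (∣singletonDifferences∣≤length∸1 M₁))

corollary2p5 : (n : ℕ) (D : Digraph n) → Locatable D →
    (S : Subset n) → ((v : Fin n) → v ∈ S → LocationForced D v) →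
    ∣ S ∣ ≤ n ∸ 1
corollary2p5 n D _ S forced =
  ≤-trans (p⊆q⇒∣p∣≤∣q∣ S⊆)
    (subst (λ m → ∣ singletonDifferences N⁻s ∣ ≤ m ∸ 1) (length-tabulate (N⁻ D))
      (∣singletonDifferences∣≤length∸1 N⁻s))
  where
  N⁻s : List (Subset n)
  N⁻s = tabulate (N⁻ D)
  S⊆ : ∀ {v} → v ∈ S → v ∈ singletonDifferences N⁻s
  S⊆ {v} v∈S with forced v v∈S
  ... | x , y , _ , N⁻x⊖N⁻y≡⁅v⁆ =
    ⊖≡⁅⁆⇒∈singletonDifferences N⁻s v (∈-tabulate⁺ x) (∈-tabulate⁺ y) N⁻x⊖N⁻y≡⁅v⁆
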